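{- For each $n\geq1$, the weighted generating function of closed polygons of the $n$-th Schreier graph $\Sigma_n$ of the Grigorchuk group is $$\Gamma^{cl}_n(a,b,c,d)=\begin{cases}(1+bc)^{\frac{2^{n+1}-2}{7}}(1+bd)^{\frac{2^n-1}{7}}(1+cd)^{\frac{2^{n-1}-4}{7}} & n\equiv 0 \pmod 3,\\[2pt] (1+bc)^{\frac{2^{n+1}-4}{7}}(1+bd)^{\frac{2^n-2}{7}}(1+cd)^{\frac{2^{n-1}-1}{7}} & n\equiv 1 \pmod 3,\\[2pt] (1+bc)^{\frac{2^{n+1}-1}{7}}(1+bd)^{\frac{2^n-4}{7}}(1+cd)^{\frac{2^{n-1}-2}{7}} & n\equiv 2 \pmod 3.\end{cases}$$
   Context: Automorphisms of the rooted binary tree (vertices = finite words over $\{0,1\}$) are written $g=\tau(g_0,g_1)$, meaning $g(xw)=\tau(x)g_x(w)$; $e$ is the trivial and $\epsilon$ the non-trivial permutation of $\{0,1\}$. The Grigorchuk group is generated by $a=\epsilon(id,id)$, $b=e(a,c)$, $c=e(a,d)$, $d=e(id,b)$. Its $n$-th Schreier graph $\Sigma_n$ has vertex set the words of length $n$, and for each generator $s\in\{a,b,c,d\}$ and each pair $\{u,s(u)\}$ with $s(u)\neq u$ one edge joining $u,s(u)$ labeled $s$ (multiple edges allowed); loops are erased. A closed polygon is a subset of the edge set in which every vertex has even degree (empty set included). The weighted generating function is $\Gamma^{cl}_n(a,b,c,d)=\sum_X\prod_{e\in X}x_{\ell(e)}$, the sum over closed polygons $X$ of $\Sigma_n$,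 where $\ell(e)\in\{a,b,c,d\}$ is the label of the edge $e$ and $x_a,x_b,x_c,x_d$ are the variables $a,b,c,d$. -}

module Defs where

open import Level using (Level)
open import Data.Bool using (Bool; true; false; not; _∧_; _∨_; if_then_else_)
open import Data.Nat using (ℕ; zero; suc; _%_; _≟_)
open import Data.List using (List; []; _∷_; _++_; map; concatMap; filter; filterᵇ; length; foldr)
open import Data.List.Relation.Unary.All using (All; all?)
open import Data.Vec using (Vec; []; _∷_)
open import Data.Product using (_×_; _,_)
open import Relation.Binary.PropositionalEquality using (_≡_)
open import Relation.Nullary using (Dec)
open import Algebra.Bundles using (CommutativeRing)

-- Letters 0,1 are encoded as false,true; vertices of Σ_n are words of length n.
Word : ℕ → Set
Word n = Vec Bool n

allWords : (n : ℕ) → List (Word n)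
allWords zero = [] ∷ []
allWords (suc n) = map (false ∷_) (allWords n) ++ map (true ∷_) (allWords n)

data Gen : Set where
  ga gb gc gd : Gen

gens : List Gen
gens = ga ∷ gb ∷ gc ∷ gd ∷ []

-- action: a = ε(id,id), b = e(a,c), c = e(a,d), d = e(id,b)
act : {n : ℕ} → Gen → Word n → Word n
act _ [] = []
act ga (x ∷ w) = not x ∷ w
act gb (false ∷ w) = false ∷ act ga w
act gb (true ∷ w) = true ∷ act gc w
act gc (false ∷ w) = false ∷ act ga w
act gc (true ∷ w) = true ∷ act gd w
act gd (false ∷ w) = false ∷ w
act gd (true ∷ w) = true ∷ act gb w

eqB : Bool → Bool → Bool
eqB false false = true
eqB true true = true
eqB _ _ = false

eqW : {n : ℕ} → Word n → Word n → Bool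
eqW [] [] = true
eqW (x ∷ w) (y ∷ v) = eqB x y ∧ eqW w v

ltW : {n : ℕ} → Word n → Word n → Bool
ltW [] [] = false
ltW (x ∷ w) (y ∷ v) = if eqB x y then ltW w v else (not x ∧ y)

-- an edge labelled s joining u and s(u); one edge per pair {u , s(u)} with s(u) ≠ u,
-- represented by the lexicographically smaller endpoint u (so u < s(u), in particular u ≠ s(u))
Edge : ℕ → Set
Edge n = Gen × Word n

edges : (n : ℕ) → List (Edge n)
edges n = filterᵇ (λ { (s , u) → ltW u (act s u) })
                  (concatMap (λ s → map (s ,_) (allWords n)) gens)

sublists : {A : Set} → List A → List (List A)
sublists [] = [] ∷ []
sublists (x ∷ xs) = sublists xs ++ map (x ∷_) (sublists xs)

incident : {n : ℕ} → Word n → Edge n → Bool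
incident v (s , u) = eqW v u ∨ eqW v (act s u)

degree : {n : ℕ} → List (Edge n) → Word n → ℕ
degree X v = length (filterᵇ (incident v) X)

Closed : {n : ℕ} → List (Edge n) → Set
Closed {n} X = All (λ v → degree X v % 2 ≡ 0) (allWords n)

closed? : {n : ℕ} → (X : List (Edge n)) → Dec (Closed X)
closed? {n} X = all? (λ v → degree X v % 2 ≟ 0) (allWords n)

closedPolygons : (n : ℕ) → List (List (Edge n))
closedPolygons n = filter closed? (sublists (edges n))

module _ {c ℓ : Level} (R : CommutativeRing c ℓ) where
  open CommutativeRing R

  pow : Carrier → ℕ → Carrier
  pow x zero = 1#
  pow x (suc k) = x * pow x k

  Gamma : (n : ℕ) → Carrier → Carrier → Carrier → Carrier → Carrier
  Gamma n xa xb xc xd =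
    foldr _+_ 0# (map (λ X → foldr _*_ 1# (map weight X)) (closedPolygons n))
    where
    label : Gen → Carrier
    label ga = xa
    label gb = xb
    label gc = xc
    label gd = xd
    weight : Edge n → Carrier
    weight (s , _) = label s

-- A polygon sum over a list of weighted edges, with a prescribed set of odd vertices, does not depend on the
-- order of the edges, and it is unchanged when two parallel edges are merged or two edges meeting at an even
-- vertex of degree two are joined (with combined weights). These reductions remove the vertices below 0 of
-- Σ_{m+2} and leave a relabelled Σ_{m+1} on the subtree below 1, the a-edges absorbing a factor 1 + bc.
-- Iterating writes Γ_{m+1} as a product of powers of 1 + bc, 1 + bd and 1 + cd whose exponents satisfy a
-- linear recursion, solved by residues mod 3.
module Submission where

open import Defs
open import Level using (Level)
open import Data.Bool using (Bool; true; false; not; _∧_; _∨_; _xor_; if_then_else_; T; T?)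
open import Data.Bool.Properties using (not-involutive; ∧-zeroʳ; ∧-assoc; xor-identityʳ)
open import Data.Bool.ListAction using (all; and)
open import Data.Bool.Solver using (module xor-∧-Solver)
open import Data.Nat as ℕ using (ℕ; zero; suc; _≤_; _∸_; _^_; _/_; _%_; _≟_)
import Data.Nat.Properties as ℕₚ
open import Data.Nat.DivMod using ([m+n]%n≡m%n; m*n/n≡m)
open import Data.Nat.Solver using (module +-*-Solver)
open import Data.List using (List; []; _∷_; _++_; map; concatMap; filter; filterᵇ; foldr)
open import Data.List.Properties
  using (map-++; map-∘; map-cong; concatMap-cong; map-concatMap; filter-++; filter-all; filter-none; ++-identityʳ)
open import Data.List.Membership.Propositional using (_∈_)
open import Data.List.Membership.Propositional.Properties using (∈-++⁺ˡ; ∈-++⁺ʳ; ∈-map⁺)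
open import Data.List.Relation.Unary.Any using (here; there)
open import Data.List.Relation.Unary.All as All using (All; []; _∷_; all?)
open import Data.List.Relation.Unary.All.Properties as All using (all-filter)
open import Data.List.Relation.Unary.AllPairs as AllPairs using (AllPairs; []; _∷_)
import Data.List.Relation.Unary.AllPairs.Properties as AllPairs
open import Data.List.Relation.Binary.Permutation.Propositional as ↭ using (_↭_; prep; swap)
import Data.List.Relation.Binary.Permutation.Propositional.Properties as ↭ₚ
open import Data.Vec using ([]; _∷_)
open import Data.Product using (_×_; _,_; proj₁; proj₂)
open import Data.Unit using (tt)
open import Data.Empty using (⊥-elim)
open import Relation.Binary.PropositionalEquality using (_≡_; _≢_; _≗_; refl; sym; trans; cong; cong₂; subst)
open import Relation.Nullary using (does)
open import Relation.Unary using (Decidable)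
open import Algebra.Bundles using (CommutativeRing)
open import Function using (_∘_)

isOdd : ℕ → Bool
isOdd zero    = false
isOdd (suc k) = not (isOdd k)

does-%2≟0 : ∀ k → does (k % 2 ≟ 0) ≡ not (isOdd k)
does-%2≟0 zero          = refl
does-%2≟0 (suc zero)    = refl
does-%2≟0 (suc (suc k)) = trans (does-%2≟0 k) (sym (not-involutive _))

module _ where
  open xor-∧-Solver

  xor-swapʳ : ∀ a b c → (a xor b) xor c ≡ (a xor c) xor b
  xor-swapʳ = solve 3 (λ a b c → (a :+ b) :+ c := (a :+ c) :+ b) refl

  xor-cancelʳ : ∀ a b → (a xor b) xor b ≡ a
  xor-cancelʳ = solve 2 (λ a b → (a :+ b) :+ b := a) refl

  xor-cancel-shared : ∀ a b c d → (a xor (b xor c)) xor (b xor d) ≡ a xor (c xor d)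
  xor-cancel-shared = solve 4 (λ a b c d → (a :+ (b :+ c)) :+ (b :+ d) := a :+ (c :+ d)) refl

  xor-rotate : ∀ a b c → (a xor b) xor c ≡ b xor (c xor a)
  xor-rotate = solve 3 (λ a b c → (a :+ b) :+ c := b :+ (c :+ a)) refl

eqB-refl : ∀ x → eqB x x ≡ true
eqB-refl false = refl
eqB-refl true  = refl

eqW-refl : ∀ {n} (w : Word n) → eqW w w ≡ true
eqW-refl []      = refl
eqW-refl (x ∷ w) rewrite eqB-refl x = eqW-refl w

eqW⇒≡ : ∀ {n} {u v : Word n} → eqW u v ≡ true → u ≡ v
eqW⇒≡ {u = []}        {[]}        _ = refl
eqW⇒≡ {u = false ∷ u} {false ∷ v} h = cong (false ∷_) (eqW⇒≡ h)
eqW⇒≡ {u = true ∷ u}  {true ∷ v}  h = cong (true ∷_) (eqW⇒≡ h)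

ltW-irrefl : ∀ {n} (w : Word n) → ltW w w ≡ false
ltW-irrefl []      = refl
ltW-irrefl (x ∷ w) rewrite eqB-refl x = ltW-irrefl w

ltW⇒≢ : ∀ {n} {u v : Word n} → T (ltW u v) → u ≢ v
ltW⇒≢ {u = u} u<u refl = subst T (ltW-irrefl u) u<u

allWords-complete : ∀ {n} (w : Word n) → w ∈ allWords n
allWords-complete []          = here refl
allWords-complete (false ∷ w) = ∈-++⁺ˡ (∈-map⁺ (false ∷_) (allWords-complete w))
allWords-complete (true ∷ w)  = ∈-++⁺ʳ (map (false ∷_) (allWords _)) (∈-map⁺ (true ∷_) (allWords-complete w))

Distinct : ∀ {n} → List (Word n) → Set
Distinct = AllPairs (λ u v → eqW u v ≡ false)

allWords-distinct : ∀ n → Distinct (allWords n)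
allWords-distinct zero    = [] ∷ []
allWords-distinct (suc n) =
  AllPairs.++⁺ (prefixed false) (prefixed true)
    (All.map⁺ (All.universal (λ _ → All.map⁺ (All.universal (λ _ → refl) (allWords n))) (allWords n)))
  where
  prefixed : ∀ b → Distinct (map (b ∷_) (allWords n))
  prefixed b = AllPairs.map⁺ (AllPairs.map (λ {u} {v} → trans (cong (_∧ eqW u v) (eqB-refl b))) (allWords-distinct n))

VanishesUnder₀ : ∀ {n} → (Word (suc n) → Bool) → Set
VanishesUnder₀ t = ∀ w → t (false ∷ w) ≡ false

module _ {A : Set} where

  all-++ : (f : A → Bool) (xs ys : List A) → all f (xs ++ ys) ≡ all f xs ∧ all f ys
  all-++ f []       ys = refl
  all-++ f (x ∷ xs) ys = trans (cong (f x ∧_) (all-++ f xs ys)) (sym (∧-assoc (f x) _ _))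

  all-map : {B : Set} (f : B → Bool) (g : A → B) (xs : List A) → all f (map g xs) ≡ all (f ∘ g) xs
  all-map f g xs = cong and (sym (map-∘ xs))

  all-cong : {f g : A → Bool} → f ≗ g → all f ≗ all g
  all-cong f≗g xs = cong and (map-cong f≗g xs)

  all-true : {f : A → Bool} → (∀ x → f x ≡ true) → ∀ xs → all f xs ≡ true
  all-true fx≡true []       = refl
  all-true fx≡true (x ∷ xs) rewrite fx≡true x = all-true fx≡true xs

  all-false : {f : A → Bool} {x : A} {xs : List A} → x ∈ xs → f x ≡ false → all f xs ≡ false
  all-false {f} (here {xs = xs} refl) fx≡false = cong (_∧ all f xs) fx≡false
  all-false {f} (there {y} x∈xs)      fx≡false = trans (cong (f y ∧_) (all-false x∈xs fx≡false)) (∧-zeroʳ (f y))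

  filterᵇ-cong : {p q : A → Bool} → p ≗ q → filterᵇ p ≗ filterᵇ q
  filterᵇ-cong p≗q [] = refl
  filterᵇ-cong {p} {q} p≗q (x ∷ xs) with p x | q x | p≗q x
  ... | true  | .true  | refl = cong (x ∷_) (filterᵇ-cong p≗q xs)
  ... | false | .false | refl = filterᵇ-cong p≗q xs

  filterᵇ-map : {B : Set} (p : B → Bool) (f : A → B) (xs : List A) →
                filterᵇ p (map f xs) ≡ map f (filterᵇ (p ∘ f) xs)
  filterᵇ-map p f [] = refl
  filterᵇ-map p f (x ∷ xs) with p (f x)
  ... | true  = cong (f x ∷_) (filterᵇ-map p f xs)
  ... | false = filterᵇ-map p f xs

  filterᵇ-concatMap : {B : Set} (p : B → Bool) (f : A → List B) (xs : List A) →
                      filterᵇ p (concatMap f xs) ≡ concatMap (filterᵇ p ∘ f) xs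
  filterᵇ-concatMap p f []       = refl
  filterᵇ-concatMap p f (x ∷ xs) =
    trans (filter-++ (T? ∘ p) (f x) (concatMap f xs)) (cong (filterᵇ p (f x) ++_) (filterᵇ-concatMap p f xs))

  filter≗filterᵇ : {P : A → Set} (P? : Decidable P) {q : A → Bool} → (∀ x → does (P? x) ≡ q x) →
                   filter P? ≗ filterᵇ q
  filter≗filterᵇ P? P?≡q [] = refl
  filter≗filterᵇ P? {q} P?≡q (x ∷ xs) with does (P? x) | q x | P?≡q x
  ... | true  | .true  | refl = cong (x ∷_) (filter≗filterᵇ P? P?≡q xs)
  ... | false | .false | refl = filter≗filterᵇ P? P?≡q xs

  does-all? : {P : A → Set} (P? : Decidable P) (xs : List A) → does (all? P? xs) ≡ all (does ∘ P?) xs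
  does-all? P? []       = refl
  does-all? P? (x ∷ xs) = cong (does (P? x) ∧_) (does-all? P? xs)

map-map : ∀ {a b c} {A : Set a} {B : Set b} {C : Set c} {f : B → C} {g : A → B} (xs : List A) →
          map f (map g xs) ≡ map (f ∘ g) xs
map-map xs = sym (map-∘ xs)

interleave-↭ : ∀ {a b} {A : Set a} {B : Set b} (f g h k : A → B) (V : List A) (Q : List B) →
               map f V ++ map g V ++ map h V ++ map k V ++ Q ↭ concatMap (λ v → f v ∷ g v ∷ h v ∷ k v ∷ []) V ++ Q
interleave-↭ f g h k []      Q = ↭.refl
interleave-↭ {B = B} f g h k (v ∷ V) Q =
  ↭.trans (solve 9 (λ fv F gv G hv H kv K Q →
                     fv ⊕ F ⊕ gv ⊕ G ⊕ hv ⊕ H ⊕ kv ⊕ K ⊕ Q ⊜ fv ⊕ gv ⊕ hv ⊕ kv ⊕ F ⊕ G ⊕ H ⊕ K ⊕ Q)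
                 ↭.refl (f v ∷ []) (map f V) (g v ∷ []) (map g V) (h v ∷ []) (map h V) (k v ∷ []) (map k V) Q)
          (prep (f v) (prep (g v) (prep (h v) (prep (k v) (interleave-↭ f g h k V Q)))))
  where open import Algebra.Solver.CommutativeMonoid (↭ₚ.++-commutativeMonoid {A = B})

-- Edges and degrees

Loopless : ∀ {n} → Edge n → Set
Loopless (s , u) = u ≢ act s u

edges-loopless : ∀ n → All Loopless (edges n)
edges-loopless n = All.map (λ { {s , u} → ltW⇒≢ }) (all-filter _ (concatMap (λ s → map (s ,_) (allWords n)) gens))

incident-loopless : ∀ {n} {e : Edge n} → Loopless e → ∀ v →
                    incident v e ≡ eqW v (proj₂ e) xor eqW v (act (proj₁ e) (proj₂ e))
incident-loopless {e = s , u} u≢su v with eqW v u in v≡u | eqW v (act s u) in v≡su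
... | true  | true  = ⊥-elim (u≢su (trans (sym (eqW⇒≡ {u = v} v≡u)) (eqW⇒≡ {u = v} v≡su)))
... | true  | false = refl
... | false | _     = refl

hasBoundary : ∀ {n} → (Word n → Bool) → List (Edge n) → Bool
hasBoundary {n} t X = all (λ v → not (isOdd (degree X v) xor t v)) (allWords n)

isOdd-degree-∷ : ∀ {n} (e : Edge n) (X : List (Edge n)) v →
                 isOdd (degree (e ∷ X) v) ≡ incident v e xor isOdd (degree X v)
isOdd-degree-∷ e X v with incident v e
... | true  = refl
... | false = refl

hasBoundary-∷ : ∀ {n} (t : Word n → Bool) (e : Edge n) (X : List (Edge n)) →
                hasBoundary t (e ∷ X) ≡ hasBoundary (λ v → t v xor incident v e) X
hasBoundary-∷ {n} t e X = all-cong
  (λ v → cong not (trans (cong (_xor t v) (isOdd-degree-∷ e X v)) (xor-rotate (incident v e) _ (t v)))) (allWords n)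

does-closed? : ∀ {n} (X : List (Edge n)) → does (closed? X) ≡ hasBoundary (λ _ → false) X
does-closed? {n} X = trans (does-all? _ (allWords n))
  (all-cong (λ v → trans (does-%2≟0 (degree X v)) (cong not (sym (xor-identityʳ _)))) (allWords n))

sources : (n : ℕ) → Gen → List (Word n)
sources n s = filterᵇ (λ u → ltW u (act s u)) (allWords n)

edges-by-generator : ∀ n → edges n ≡ concatMap (λ s → map (s ,_) (sources n s)) gens
edges-by-generator n =
  -- the selector of `edges`, in the projection form that its record-pattern lambda elaborates to
  trans (filterᵇ-concatMap _ (λ s → map (s ,_) (allWords n)) gens)
        (concatMap-cong (λ s → filterᵇ-map (λ e → ltW (proj₂ e) (act (proj₁ e) (proj₂ e))) (s ,_) (allWords n)) gens)

module _ (n : ℕ) where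
  private
    W : List (Word n)
    W = allWords n

  sources-a : sources (suc n) ga ≡ map (false ∷_) W
  sources-a = trans (filter-++ _ (map (false ∷_) W) (map (true ∷_) W))
    (trans (cong₂ _++_
             (trans (filterᵇ-map _ (false ∷_) W) (cong (map (false ∷_)) (filter-all _ (All.universal (λ _ → tt) W))))
             (trans (filterᵇ-map _ (true ∷_) W) (cong (map (true ∷_)) (filter-none _ (All.universal (λ _ ()) W)))))
           (++-identityʳ _))

  sources-b : sources (suc n) gb ≡ map (false ∷_) (sources n ga) ++ map (true ∷_) (sources n gc)
  sources-b = trans (filter-++ _ (map (false ∷_) W) (map (true ∷_) W))
                    (cong₂ _++_ (filterᵇ-map _ (false ∷_) W) (filterᵇ-map _ (true ∷_) W))

  sources-c : sources (suc n) gc ≡ map (false ∷_) (sources n ga) ++ map (true ∷_) (sources n gd)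
  sources-c = trans (filter-++ _ (map (false ∷_) W) (map (true ∷_) W))
                    (cong₂ _++_ (filterᵇ-map _ (false ∷_) W) (filterᵇ-map _ (true ∷_) W))

  sources-d : sources (suc n) gd ≡ map (true ∷_) (sources n gb)
  sources-d = trans (filter-++ _ (map (false ∷_) W) (map (true ∷_) W))
    (cong₂ _++_ (trans (filterᵇ-map _ (false ∷_) W)
                       (cong (map (false ∷_)) (filter-none _ (All.universal (λ w → subst T (ltW-irrefl w)) W))))
                (filterᵇ-map _ (true ∷_) W))

-- Exponents of 1 + bc, 1 + bd and 1 + cd in Γ_{m+1}.
bcExponent bdExponent cdExponent : ℕ → ℕ
bcExponent zero    = 0
bcExponent (suc m) = 2 ^ m ℕ.+ cdExponent m
bdExponent zero    = 0
bdExponent (suc m) = bcExponent m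
cdExponent zero    = 0
cdExponent (suc m) = bdExponent m

-- The exponent (2^k ∸ r) / 7 of the theorem is certified by 7e + r = 2^k.
record ExponentsAt (m r₁ r₂ r₃ : ℕ) : Set where
  constructor exponentsAt
  field
    bc : 7 ℕ.* bcExponent m ℕ.+ r₁ ≡ 2 ^ suc (suc m)
    bd : 7 ℕ.* bdExponent m ℕ.+ r₂ ≡ 2 ^ suc m
    cd : 7 ℕ.* cdExponent m ℕ.+ r₃ ≡ 2 ^ m

exponentsAt-zero : ExponentsAt 0 4 2 1
exponentsAt-zero = exponentsAt refl refl refl

exponentsAt-suc : ∀ {m r₁ r₂ r₃} → ExponentsAt m r₁ r₂ r₃ → ExponentsAt (suc m) r₃ r₁ r₂
exponentsAt-suc {m} {r₃ = r₃} (exponentsAt e₁ e₂ e₃) = exponentsAt (eightfold (cdExponent m) r₃ e₃) e₁ e₂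
  where
  eightfold : ∀ {p} q r → 7 ℕ.* q ℕ.+ r ≡ p → 7 ℕ.* (p ℕ.+ q) ℕ.+ r ≡ 2 ℕ.* (2 ℕ.* (2 ℕ.* p))
  eightfold q r refl =
    solve 2 (λ q r → con 7 :* ((con 7 :* q :+ r) :+ q) :+ r := con 2 :* (con 2 :* (con 2 :* (con 7 :* q :+ r))))
            refl q r
    where open +-*-Solver

exponentsAt-+3 : ∀ {m r₁ r₂ r₃} → ExponentsAt m r₁ r₂ r₃ → ExponentsAt (3 ℕ.+ m) r₁ r₂ r₃
exponentsAt-+3 = exponentsAt-suc ∘ exponentsAt-suc ∘ exponentsAt-suc

exponentsAt-residue : ∀ m → (suc m % 3 ≡ 0 → ExponentsAt m 2 1 4)
                          × (suc m % 3 ≡ 1 → ExponentsAt m 4 2 1)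
                          × (suc m % 3 ≡ 2 → ExponentsAt m 1 4 2)
exponentsAt-residue 0 = (λ ()) , (λ _ → exponentsAt-zero) , (λ ())
exponentsAt-residue 1 = (λ ()) , (λ ()) , (λ _ → exponentsAt-suc exponentsAt-zero)
exponentsAt-residue 2 = (λ _ → exponentsAt-suc (exponentsAt-suc exponentsAt-zero)) , (λ ()) , (λ ())
exponentsAt-residue (suc (suc (suc m))) with exponentsAt-residue m
... | e₀ , e₁ , e₂ = exponentsAt-+3 ∘ e₀ ∘ periodic , exponentsAt-+3 ∘ e₁ ∘ periodic , exponentsAt-+3 ∘ e₂ ∘ periodic
  where
  periodic : ∀ {r} → (3 ℕ.+ suc m) % 3 ≡ r → suc m % 3 ≡ r
  periodic = trans (sym (trans (cong (_% 3) (ℕₚ.+-comm 3 (suc m))) ([m+n]%n≡m%n (suc m) 3)))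

exponent-from : ∀ e r {p} → 7 ℕ.* e ℕ.+ r ≡ p → (p ∸ r) / 7 ≡ e
exponent-from e r refl = trans (cong (_/ 7) (trans (ℕₚ.m+n∸n≡m (7 ℕ.* e) r) (ℕₚ.*-comm 7 e))) (m*n/n≡m e 7)

-- Polygon sums

module PolygonSums {c ℓ : Level} (R : CommutativeRing c ℓ) where

  open CommutativeRing R renaming (refl to ≈-refl; sym to ≈-sym; trans to ≈-trans; reflexive to ≈-reflexive)
  open import Relation.Binary.Reasoning.Setoid setoid
  open import Algebra.Solver.Ring.NaturalCoefficients.Default commutativeSemiring

  -- The factor an edge contributes to a polygon when it is absent from it, and when it is present.
  Weights : Set c
  Weights = Carrier × Carrier

  infixl 6 _∥_ _⋯_

  _∥_ : Weights → Weights → Weights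
  (a₀ , a₁) ∥ (b₀ , b₁) = (a₀ * b₀ + a₁ * b₁ , a₀ * b₁ + a₁ * b₀)

  _⋯_ : Weights → Weights → Weights
  (a₀ , a₁) ⋯ (b₀ , b₁) = (a₀ * b₀ , a₁ * b₁)

  record WeightedEdge (n : ℕ) : Set c where
    constructor wedge
    field
      src tgt : Word n
      weights : Weights

    absent present : Carrier
    absent  = proj₁ weights
    present = proj₂ weights

  open WeightedEdge public

  infixl 6 _△_

  _△_ : ∀ {n} → (Word n → Bool) → WeightedEdge n → Word n → Bool
  (t △ e) v = t v xor (eqW v (src e) xor eqW v (tgt e))

  Avoids : ∀ {n} → Word n → WeightedEdge n → Set
  Avoids x e = eqW x (src e) ∨ eqW x (tgt e) ≡ false

  -- polygonSum E t sums, over the subsets X of E whose odd-degree vertices are exactly those where t holds,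
  -- the product of the present weights of the edges in X and the absent weights of the others.
  polygonSum : ∀ {n} → List (WeightedEdge n) → (Word n → Bool) → Carrier
  polygonSum {n} []      t = if all (not ∘ t) (allWords n) then 1# else 0#
  polygonSum     (e ∷ E) t = absent e * polygonSum E t + present e * polygonSum E (t △ e)

  polygonSum-cong : ∀ {n} (E : List (WeightedEdge n)) {t t′ : Word n → Bool} → t ≗ t′ →
                    polygonSum E t ≈ polygonSum E t′
  polygonSum-cong {n} []      t≗t′ =
    ≈-reflexive (cong (if_then 1# else 0#) (all-cong (cong not ∘ t≗t′) (allWords n)))
  polygonSum-cong     (e ∷ E) t≗t′ =
    +-cong (*-cong ≈-refl (polygonSum-cong E t≗t′)) (*-cong ≈-refl (polygonSum-cong E (cong (_xor _) ∘ t≗t′)))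

  polygonSum-∷⁺ : ∀ {n} (e : WeightedEdge n) {E E′ : List (WeightedEdge n)} →
                  (∀ t → polygonSum E t ≈ polygonSum E′ t) → ∀ t → polygonSum (e ∷ E) t ≈ polygonSum (e ∷ E′) t
  polygonSum-∷⁺ e E≈E′ t = +-cong (*-cong ≈-refl (E≈E′ t)) (*-cong ≈-refl (E≈E′ (t △ e)))

  polygonSum-isolated : ∀ {n} (E : List (WeightedEdge n)) {t : Word n → Bool} {x : Word n} →
                        t x ≡ true → All (Avoids x) E → polygonSum E t ≈ 0#
  polygonSum-isolated []      {x = x} tx≡true [] =
    ≈-reflexive (cong (if_then 1# else 0#) (all-false (allWords-complete x) (cong not tx≡true)))
  polygonSum-isolated (e ∷ E) {t} {x} tx≡true (x∉e ∷ x∉E) = begin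
      absent e * polygonSum E t + present e * polygonSum E (t △ e)
    ≈⟨ +-cong (*-cong ≈-refl (polygonSum-isolated E tx≡true x∉E))
              (*-cong ≈-refl (polygonSum-isolated E (still-odd (eqW x (src e)) (eqW x (tgt e)) tx≡true x∉e) x∉E)) ⟩
      absent e * 0# + present e * 0#
    ≈⟨ solve 2 (λ a b → a :* con 0 :+ b :* con 0 := con 0) ≈-refl (absent e) (present e) ⟩
      0# ∎
    where
    still-odd : ∀ {b} p q → b ≡ true → p ∨ q ≡ false → b xor (p xor q) ≡ true
    still-odd false false refl _ = refl

  polygonSum-swap : ∀ {n} (e f : WeightedEdge n) (E : List (WeightedEdge n)) (t : Word n → Bool) →
                    polygonSum (e ∷ f ∷ E) t ≈ polygonSum (f ∷ e ∷ E) t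
  polygonSum-swap {n} e f E t = begin
      absent e * (absent f * Z t + present f * Z (t △ f))
        + present e * (absent f * Z (t △ e) + present f * Z (t △ e △ f))
    ≈⟨ +-cong ≈-refl (*-cong ≈-refl (+-cong ≈-refl (*-cong ≈-refl
         (polygonSum-cong E (λ v → xor-swapʳ (t v) _ _))))) ⟩
      absent e * (absent f * Z t + present f * Z (t △ f))
        + present e * (absent f * Z (t △ e) + present f * Z (t △ f △ e))
    ≈⟨ solve 8 (λ e₀ e₁ f₀ f₁ z z₁ z₂ z₃ →
                  e₀ :* (f₀ :* z :+ f₁ :* z₁) :+ e₁ :* (f₀ :* z₂ :+ f₁ :* z₃)
                  := f₀ :* (e₀ :* z :+ e₁ :* z₂) :+ f₁ :* (e₀ :* z₁ :+ e₁ :* z₃))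
             ≈-refl (absent e) (present e) (absent f) (present f) _ _ _ _ ⟩
      absent f * (absent e * Z t + present e * Z (t △ e))
        + present f * (absent e * Z (t △ f) + present e * Z (t △ f △ e)) ∎
    where
    Z : (Word n → Bool) → Carrier
    Z = polygonSum E

  polygonSum-↭ : ∀ {n} {E E′ : List (WeightedEdge n)} → E ↭ E′ → ∀ t → polygonSum E t ≈ polygonSum E′ t
  polygonSum-↭ ↭.refl                               t = ≈-refl
  polygonSum-↭ (prep {xs = E} {ys = E′} e E↭E′)     t = polygonSum-∷⁺ e {E} {E′} (polygonSum-↭ E↭E′) t
  polygonSum-↭ (swap {xs = E} {ys = E′} e f E↭E′)   t =
    ≈-trans (polygonSum-swap e f E t)
            (polygonSum-∷⁺ f {e ∷ E} {e ∷ E′} (polygonSum-∷⁺ e {E} {E′} (polygonSum-↭ E↭E′)) t)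
  polygonSum-↭ (↭.trans E↭E′ E′↭E″)                t = ≈-trans (polygonSum-↭ E↭E′ t) (polygonSum-↭ E′↭E″ t)

  polygonSum-parallel : ∀ {n} (u v : Word n) (w w′ : Weights) (E : List (WeightedEdge n)) (t : Word n → Bool) →
                        polygonSum (wedge u v w ∷ wedge u v w′ ∷ E) t ≈ polygonSum (wedge u v (w ∥ w′) ∷ E) t
  polygonSum-parallel {n} u v (w₀ , w₁) (w₀′ , w₁′) E t = begin
      w₀ * (w₀′ * Z t + w₁′ * Z (t △ e)) + w₁ * (w₀′ * Z (t △ e) + w₁′ * Z (t △ e △ e))
    ≈⟨ +-cong ≈-refl (*-cong ≈-refl (+-cong ≈-refl (*-cong ≈-refl
         (polygonSum-cong E (λ y → xor-cancelʳ (t y) _))))) ⟩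
      w₀ * (w₀′ * Z t + w₁′ * Z (t △ e)) + w₁ * (w₀′ * Z (t △ e) + w₁′ * Z t)
    ≈⟨ solve 6 (λ w₀ w₁ w₀′ w₁′ z z′ →
                  w₀ :* (w₀′ :* z :+ w₁′ :* z′) :+ w₁ :* (w₀′ :* z′ :+ w₁′ :* z)
                  := (w₀ :* w₀′ :+ w₁ :* w₁′) :* z :+ (w₀ :* w₁′ :+ w₁ :* w₀′) :* z′)
             ≈-refl w₀ w₁ w₀′ w₁′ _ _ ⟩
      (w₀ * w₀′ + w₁ * w₁′) * Z t + (w₀ * w₁′ + w₁ * w₀′) * Z (t △ e) ∎
    where
    Z : (Word n → Bool) → Carrier
    Z = polygonSum E
    e : WeightedEdge n
    e = wedge u v (w₀ , w₁)

  polygonSum-series : ∀ {n} {x u₁ u₂ : Word n} (w₁ w₂ : Weights) (E : List (WeightedEdge n)) {t : Word n → Bool} →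
                      t x ≡ false → eqW x u₁ ≡ false → eqW x u₂ ≡ false → All (Avoids x) E →
                      polygonSum (wedge x u₁ w₁ ∷ wedge x u₂ w₂ ∷ E) t ≈ polygonSum (wedge u₁ u₂ (w₁ ⋯ w₂) ∷ E) t
  polygonSum-series {n} {x} {u₁} {u₂} (a₀ , a₁) (b₀ , b₁) E {t} tx≡false x≢u₁ x≢u₂ x∉E = begin
      a₀ * (b₀ * Z t + b₁ * Z (t △ e₂)) + a₁ * (b₀ * Z (t △ e₁) + b₁ * Z (t △ e₁ △ e₂))
    ≈⟨ +-cong (*-cong ≈-refl (+-cong ≈-refl (*-cong ≈-refl (polygonSum-isolated E (x-odd-after (b₀ , b₁) x≢u₂) x∉E))))
              (*-cong ≈-refl (+-cong (*-cong ≈-refl (polygonSum-isolated E (x-odd-after (a₀ , a₁) x≢u₁) x∉E))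
                                     (*-cong ≈-refl (polygonSum-cong E
                                       (λ y → xor-cancel-shared (t y) (eqW y x) _ _))))) ⟩
      a₀ * (b₀ * Z t + b₁ * 0#) + a₁ * (b₀ * 0# + b₁ * Z (t △ e₁₂))
    ≈⟨ solve 6 (λ a₀ a₁ b₀ b₁ z z′ →
                  a₀ :* (b₀ :* z :+ b₁ :* con 0) :+ a₁ :* (b₀ :* con 0 :+ b₁ :* z′)
                  := (a₀ :* b₀) :* z :+ (a₁ :* b₁) :* z′)
             ≈-refl a₀ a₁ b₀ b₁ _ _ ⟩
      (a₀ * b₀) * Z t + (a₁ * b₁) * Z (t △ e₁₂) ∎
    where
    Z : (Word n → Bool) → Carrier
    Z = polygonSum E
    e₁ e₂ e₁₂ : WeightedEdge n
    e₁ = wedge x u₁ (a₀ , a₁)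
    e₂ = wedge x u₂ (b₀ , b₁)
    e₁₂ = wedge u₁ u₂ (a₀ * b₀ , a₁ * b₁)
    x-odd-after : ∀ {u} w → eqW x u ≡ false → (t △ wedge x u w) x ≡ true
    x-odd-after w x≢u rewrite tx≡false | eqW-refl x | x≢u = refl

  liftTrue : ∀ {n} → WeightedEdge n → WeightedEdge (suc n)
  liftTrue (wedge u v w) = wedge (true ∷ u) (true ∷ v) w

  △-liftTrue : ∀ {n} (t : Word (suc n) → Bool) (e : WeightedEdge n) →
               VanishesUnder₀ t → VanishesUnder₀ (t △ liftTrue e)
  △-liftTrue t e t₀≡false w rewrite t₀≡false w = refl

  polygonSum-liftTrue : ∀ {n} (E : List (WeightedEdge n)) (t : Word (suc n) → Bool) → VanishesUnder₀ t →
                        polygonSum (map liftTrue E) t ≈ polygonSum E (t ∘ (true ∷_))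
  polygonSum-liftTrue {n} [] t t₀≡false = ≈-reflexive (cong (if_then 1# else 0#)
    (trans (all-++ (not ∘ t) (map (false ∷_) (allWords n)) (map (true ∷_) (allWords n)))
           (cong₂ _∧_ (trans (all-map (not ∘ t) (false ∷_) (allWords n)) (all-true (cong not ∘ t₀≡false) (allWords n)))
                      (all-map (not ∘ t) (true ∷_) (allWords n)))))
  polygonSum-liftTrue (e ∷ E) t t₀≡false =
    +-cong (*-cong ≈-refl (polygonSum-liftTrue E t t₀≡false))
           (*-cong ≈-refl (polygonSum-liftTrue E (t △ liftTrue e) (△-liftTrue t e t₀≡false)))

  subsetSum : ∀ {n} → (Edge n → Carrier) → List (List (Edge n)) → Carrier
  subsetSum wt Xs = foldr _+_ 0# (map (λ X → foldr _*_ 1# (map wt X)) Xs)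

  subsetSum-++ : ∀ {n} (wt : Edge n → Carrier) Xs Ys → subsetSum wt (Xs ++ Ys) ≈ subsetSum wt Xs + subsetSum wt Ys
  subsetSum-++ wt []       Ys = ≈-sym (+-identityˡ _)
  subsetSum-++ wt (X ∷ Xs) Ys = ≈-trans (+-cong ≈-refl (subsetSum-++ wt Xs Ys)) (≈-sym (+-assoc _ _ _))

  subsetSum-map-∷ : ∀ {n} (wt : Edge n → Carrier) e Xs → subsetSum wt (map (e ∷_) Xs) ≈ wt e * subsetSum wt Xs
  subsetSum-map-∷ wt e []       = ≈-sym (zeroʳ _)
  subsetSum-map-∷ wt e (X ∷ Xs) = ≈-trans (+-cong ≈-refl (subsetSum-map-∷ wt e Xs)) (≈-sym (distribˡ _ _ _))

  subsetSum-singleton : ∀ {n} (wt : Edge n → Carrier) (p : List (Edge n) → Bool) →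
                        subsetSum wt (filterᵇ p ([] ∷ [])) ≈ (if p [] then 1# else 0#)
  subsetSum-singleton wt p with p []
  ... | true  = +-identityʳ 1#
  ... | false = ≈-refl

  toWeighted : ∀ {n} → (Edge n → Carrier) → Edge n → WeightedEdge n
  toWeighted wt (s , u) = wedge u (act s u) (1# , wt (s , u))

  subsetSum≈polygonSum : ∀ {n} (wt : Edge n → Carrier) (E : List (Edge n)) → All Loopless E → ∀ t →
    subsetSum wt (filterᵇ (hasBoundary t) (sublists E)) ≈ polygonSum (map (toWeighted wt) E) t
  subsetSum≈polygonSum wt []      []                        t = subsetSum-singleton wt (hasBoundary t)
  subsetSum≈polygonSum {n} wt (e ∷ E) (e-loopless ∷ E-loopless) t = begin
      subsetSum wt (filterᵇ (hasBoundary t) (sublists E ++ map (e ∷_) (sublists E)))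
    ≡⟨ cong (subsetSum wt) (trans (filter-++ _ (sublists E) _)
         (cong (Xs ++_) (trans (filterᵇ-map (hasBoundary t) (e ∷_) (sublists E))
                               (cong (map (e ∷_)) (filterᵇ-cong (hasBoundary-∷ t e) (sublists E)))))) ⟩
      subsetSum wt (Xs ++ map (e ∷_) Xs′)
    ≈⟨ ≈-trans (subsetSum-++ wt Xs (map (e ∷_) Xs′)) (+-cong ≈-refl (subsetSum-map-∷ wt e Xs′)) ⟩
      subsetSum wt Xs + wt e * subsetSum wt Xs′
    ≈⟨ +-cong (≈-trans (subsetSum≈polygonSum wt E E-loopless t) (≈-sym (*-identityˡ _)))
              (*-cong ≈-refl (≈-trans (subsetSum≈polygonSum wt E E-loopless t′)
                                      (polygonSum-cong E′ (λ v → cong (t v xor_) (incident-loopless e-loopless v))))) ⟩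
      1# * polygonSum E′ t + wt e * polygonSum E′ (t △ toWeighted wt e) ∎
    where
    t′ : Word n → Bool
    t′ v = t v xor incident v e
    Xs Xs′ : List (List (Edge n))
    Xs  = filterᵇ (hasBoundary t) (sublists E)
    Xs′ = filterᵇ (hasBoundary t′) (sublists E)
    E′ : List (WeightedEdge n)
    E′ = map (toWeighted wt) E

  closedSubsetSum≈polygonSum : ∀ {n} (wt : Edge n → Carrier) (E : List (Edge n)) → All Loopless E →
    subsetSum wt (filter closed? (sublists E)) ≈ polygonSum (map (toWeighted wt) E) (λ _ → false)
  closedSubsetSum≈polygonSum wt E E-loopless =
    ≈-trans (≈-reflexive (cong (subsetSum wt) (filter≗filterᵇ closed? does-closed? (sublists E))))
            (subsetSum≈polygonSum wt E E-loopless (λ _ → false))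

-- Polygon sums of the Schreier graphs

module SchreierPolygonSums {c ℓ : Level} (R : CommutativeRing c ℓ) where

  open CommutativeRing R renaming (refl to ≈-refl; sym to ≈-sym; trans to ≈-trans; reflexive to ≈-reflexive)
  open import Relation.Binary.Reasoning.Setoid setoid
  open import Algebra.Solver.Ring.NaturalCoefficients.Default commutativeSemiring
  open import Algebra.Properties.CommutativeSemiring.Exp commutativeSemiring
    using (^-distrib-*) renaming (_^_ to infixr 8 _^ᴿ_)
  open import Algebra.Properties.Semiring.Exp semiring using (^-homo-*; ^-congˡ; ^-congʳ)
  open PolygonSums R

  Labelling : Set c
  Labelling = Gen → Weights

  schreierEdge : ∀ {n} → Labelling → Gen → Word n → WeightedEdge n
  schreierEdge L s u = wedge u (act s u) (L s)

  schreierEdges : (n : ℕ) → Labelling → List (WeightedEdge n)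
  schreierEdges n L = concatMap (λ s → map (schreierEdge L s) (sources n s)) gens

  schreierEdges-cong : ∀ n {L L′ : Labelling} → L ≗ L′ → schreierEdges n L ≡ schreierEdges n L′
  schreierEdges-cong n L≗L′ =
    concatMap-cong (λ s → map-cong (λ u → cong (wedge u (act s u)) (L≗L′ s)) (sources n s)) gens

  gridLabelling : Weights → Carrier → Carrier → Carrier → Labelling
  gridLabelling A x y z ga = A
  gridLabelling A x y z gb = (1# , x)
  gridLabelling A x y z gc = (1# , y)
  gridLabelling A x y z gd = (1# , z)

  map-toWeighted-edges : ∀ n (wt : Edge n → Carrier) (L : Labelling) →
                         (∀ s u → toWeighted wt (s , u) ≡ schreierEdge L s u) →
                         map (toWeighted wt) (edges n) ≡ schreierEdges n L
  map-toWeighted-edges n wt L wt≡L =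
    trans (cong (map (toWeighted wt)) (edges-by-generator n))
          (trans (map-concatMap (toWeighted wt) (λ s → map (s ,_) (sources n s)) gens)
                 (concatMap-cong (λ s → trans (sym (map-∘ {g = toWeighted wt} {f = s ,_} (sources n s)))
                                              (map-cong (wt≡L s) (sources n s))) gens))

  Gamma≈polygonSum : ∀ n a b c d →
                     Gamma R n a b c d ≈ polygonSum (schreierEdges n (gridLabelling (1# , a) b c d)) (λ _ → false)
  Gamma≈polygonSum n a b c d =
    ≈-trans (closedSubsetSum≈polygonSum _ (edges n) (edges-loopless n))
            (≈-reflexive (cong (λ E → polygonSum E (λ _ → false))
              (map-toWeighted-edges n _ (gridLabelling (1# , a) b c d)
                                    λ { ga u → refl ; gb u → refl ; gc u → refl ; gd u → refl })))

  -- Merging the parallel b- and c-edges 00v–01v of Σ_{m+2}, then joining the result in series with the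
  -- a-edge at 00v and that with the a-edge at 01v, gives the a-edge 10v–11v; below 1, b, c, d act as c, d, b.
  renormalised : Labelling → Labelling
  renormalised L ga = ((L gb ∥ L gc) ⋯ L ga) ⋯ L ga
  renormalised L gb = L gd
  renormalised L gc = L gb
  renormalised L gd = L gc

  module Renormalisation (L : Labelling) (m : ℕ) where

    private
      V : List (Word m)
      V = allWords m

      L′ : Labelling
      L′ = renormalised L

    aEdge₀ aEdge₁ bEdge cEdge reducedEdge : Word m → WeightedEdge (suc (suc m))
    aEdge₀ v = schreierEdge L ga (false ∷ false ∷ v)
    aEdge₁ v = schreierEdge L ga (false ∷ true ∷ v)
    bEdge  v = schreierEdge L gb (false ∷ false ∷ v)
    cEdge  v = schreierEdge L gc (false ∷ false ∷ v)
    reducedEdge v = liftTrue (schreierEdge L′ ga (false ∷ v))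

    gadget : Word m → List (WeightedEdge (suc (suc m)))
    gadget v = bEdge v ∷ cEdge v ∷ aEdge₀ v ∷ aEdge₁ v ∷ []

    gadgets : List (Word m) → List (WeightedEdge (suc (suc m)))
    gadgets = concatMap gadget

    reduce-gadget : ∀ v E t → t (false ∷ false ∷ v) ≡ false → t (false ∷ true ∷ v) ≡ false →
                    All (Avoids (false ∷ false ∷ v)) E → All (Avoids (false ∷ true ∷ v)) E →
                    polygonSum (gadget v ++ E) t ≈ polygonSum (reducedEdge v ∷ E) t
    reduce-gadget v E t t00≡false t01≡false 00∉E 01∉E = begin
        polygonSum (bEdge v ∷ cEdge v ∷ aEdge₀ v ∷ aEdge₁ v ∷ E) t
      ≈⟨ polygonSum-parallel _ _ (L gb) (L gc) (aEdge₀ v ∷ aEdge₁ v ∷ E) t ⟩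
        polygonSum (wedge (false ∷ false ∷ v) (false ∷ true ∷ v) (L gb ∥ L gc) ∷ aEdge₀ v ∷ aEdge₁ v ∷ E) t
      ≈⟨ polygonSum-series (L gb ∥ L gc) (L ga) (aEdge₁ v ∷ E) t00≡false refl refl (refl ∷ 00∉E) ⟩
        polygonSum (wedge (false ∷ true ∷ v) (true ∷ false ∷ v) ((L gb ∥ L gc) ⋯ L ga) ∷ aEdge₁ v ∷ E) t
      ≈⟨ polygonSum-series ((L gb ∥ L gc) ⋯ L ga) (L ga) E t01≡false refl refl 01∉E ⟩
        polygonSum (reducedEdge v ∷ E) t ∎

    gadget-avoids : ∀ b {v v′} → eqW v v′ ≡ false → All (Avoids (false ∷ b ∷ v)) (gadget v′)
    gadget-avoids false v≢v′ = cong (_∨ false) v≢v′ ∷ cong (_∨ false) v≢v′ ∷ cong (_∨ false) v≢v′ ∷ refl ∷ []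
    gadget-avoids true  v≢v′ = v≢v′ ∷ v≢v′ ∷ refl ∷ cong (_∨ false) v≢v′ ∷ []

    gadgets-avoid : ∀ b {v} V E → All (λ v′ → eqW v v′ ≡ false) V → All (Avoids (false ∷ b ∷ v)) E →
                    All (Avoids (false ∷ b ∷ v)) (gadgets V ++ E)
    gadgets-avoid b []       E []           v∉E = v∉E
    gadgets-avoid b (v′ ∷ V) E (v≢v′ ∷ v∉V) v∉E = All.++⁺ (gadget-avoids b v≢v′) (gadgets-avoid b V E v∉V v∉E)

    reduce-gadgets : ∀ V → Distinct V → ∀ E → (∀ w → All (Avoids (false ∷ w)) E) → ∀ t → VanishesUnder₀ t →
                     polygonSum (gadgets V ++ E) t ≈ polygonSum (map reducedEdge V ++ E) t
    reduce-gadgets []      _                  E E-avoids t t₀≡false = ≈-refl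
    reduce-gadgets (v ∷ V) (v∉V ∷ V-distinct) E E-avoids t t₀≡false = begin
        polygonSum (gadget v ++ gadgets V ++ E) t
      ≈⟨ reduce-gadget v (gadgets V ++ E) t (t₀≡false (false ∷ v)) (t₀≡false (true ∷ v))
           (gadgets-avoid false V E v∉V (E-avoids (false ∷ v))) (gadgets-avoid true V E v∉V (E-avoids (true ∷ v))) ⟩
        polygonSum (reducedEdge v ∷ gadgets V ++ E) t
      ≈⟨ +-cong (*-cong ≈-refl (reduce-gadgets V V-distinct E E-avoids t t₀≡false))
                (*-cong ≈-refl (reduce-gadgets V V-distinct E E-avoids (t △ reducedEdge v)
                                 (△-liftTrue t (schreierEdge L′ ga (false ∷ v)) t₀≡false))) ⟩
        polygonSum (reducedEdge v ∷ map reducedEdge V ++ E) t ∎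

    coarseEdges : Gen → List (WeightedEdge (suc m))
    coarseEdges s = map (schreierEdge L′ s) (sources (suc m) s)

    upperB upperC upperD upper : List (WeightedEdge (suc (suc m)))
    upperB = map liftTrue (coarseEdges gc)
    upperC = map liftTrue (coarseEdges gd)
    upperD = map liftTrue (coarseEdges gb)
    upper  = upperB ++ upperC ++ upperD

    a-block : map (schreierEdge L ga) (sources (suc (suc m)) ga) ≡ map aEdge₀ V ++ map aEdge₁ V
    a-block = trans (cong (map _) (sources-a (suc m)))
              (trans (map-map _) (trans (map-++ _ (map (false ∷_) V) (map (true ∷_) V))
                                        (cong₂ _++_ (map-map V) (map-map V))))

    b-block : map (schreierEdge L gb) (sources (suc (suc m)) gb) ≡ map bEdge V ++ upperB
    b-block = trans (cong (map _) (sources-b (suc m)))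
              (trans (map-++ _ (map (false ∷_) (sources (suc m) ga)) _)
                     (cong₂ _++_ (trans (cong (map (schreierEdge L gb) ∘ map (false ∷_)) (sources-a m))
                                        (trans (map-map _) (map-map V)))
                                 (trans (map-map _) (map-∘ (sources (suc m) gc)))))

    c-block : map (schreierEdge L gc) (sources (suc (suc m)) gc) ≡ map cEdge V ++ upperC
    c-block = trans (cong (map _) (sources-c (suc m)))
              (trans (map-++ _ (map (false ∷_) (sources (suc m) ga)) _)
                     (cong₂ _++_ (trans (cong (map (schreierEdge L gc) ∘ map (false ∷_)) (sources-a m))
                                        (trans (map-map _) (map-map V)))
                                 (trans (map-map _) (map-∘ (sources (suc m) gd)))))

    d-block : map (schreierEdge L gd) (sources (suc (suc m)) gd) ≡ upperD
    d-block = trans (cong (map _) (sources-d (suc m))) (trans (map-map _) (map-∘ (sources (suc m) gb)))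

    lifted-a-block : map liftTrue (coarseEdges ga) ≡ map reducedEdge V
    lifted-a-block = trans (cong (map liftTrue ∘ map _) (sources-a m)) (trans (map-map _) (map-map V))

    schreierEdges↭gadgets : schreierEdges (suc (suc m)) L ↭ gadgets V ++ upper
    schreierEdges↭gadgets = ↭.trans
      (subst (_↭ map bEdge V ++ map cEdge V ++ map aEdge₀ V ++ map aEdge₁ V ++ upper)
             (sym (cong₂ _++_ a-block (cong₂ _++_ b-block (cong₂ _++_ c-block (cong (_++ []) d-block)))))
             (solve-↭ 7 (λ A₀ A₁ B C B′ C′ D′ →
                          (A₀ ⊕ A₁) ⊕ (B ⊕ B′) ⊕ (C ⊕ C′) ⊕ D′ ⊕ id ⊜ B ⊕ C ⊕ A₀ ⊕ A₁ ⊕ B′ ⊕ C′ ⊕ D′)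
                      ↭.refl (map aEdge₀ V) (map aEdge₁ V) (map bEdge V) (map cEdge V) upperB upperC upperD))
      (interleave-↭ bEdge cEdge aEdge₀ aEdge₁ V upper)
      where
      open import Algebra.Solver.CommutativeMonoid (↭ₚ.++-commutativeMonoid {A = WeightedEdge (suc (suc m))})
        renaming (solve to solve-↭)

    reduced↭lifted : map reducedEdge V ++ upper ↭ map liftTrue (schreierEdges (suc m) L′)
    reduced↭lifted =
      subst (map reducedEdge V ++ upper ↭_)
            (sym (trans (map-concatMap liftTrue coarseEdges gens)
                        (cong (_++ upperD ++ upperB ++ upperC ++ []) lifted-a-block)))
            (↭ₚ.++⁺ˡ (map reducedEdge V)
                     (solve-↭ 3 (λ B C D → B ⊕ C ⊕ D ⊜ D ⊕ B ⊕ C ⊕ id) ↭.refl upperB upperC upperD))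
      where
      open import Algebra.Solver.CommutativeMonoid (↭ₚ.++-commutativeMonoid {A = WeightedEdge (suc (suc m))})
        renaming (solve to solve-↭)

    upper-avoids : ∀ w → All (Avoids (false ∷ w)) upper
    upper-avoids w =
      All.++⁺ (lifted-avoids (coarseEdges gc))
              (All.++⁺ (lifted-avoids (coarseEdges gd)) (lifted-avoids (coarseEdges gb)))
      where
      lifted-avoids : ∀ (E : List (WeightedEdge (suc m))) → All (Avoids (false ∷ w)) (map liftTrue E)
      lifted-avoids E = All.map⁺ (All.universal (λ _ → refl) E)

    polygonSum-renormalise : polygonSum (schreierEdges (suc (suc m)) L) (λ _ → false) ≈
                             polygonSum (schreierEdges (suc m) L′) (λ _ → false)
    polygonSum-renormalise = begin
        polygonSum (schreierEdges (suc (suc m)) L) (λ _ → false)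
      ≈⟨ polygonSum-↭ schreierEdges↭gadgets _ ⟩
        polygonSum (gadgets V ++ upper) (λ _ → false)
      ≈⟨ reduce-gadgets V (allWords-distinct m) upper upper-avoids _ (λ _ → refl) ⟩
        polygonSum (map reducedEdge V ++ upper) (λ _ → false)
      ≈⟨ polygonSum-↭ reduced↭lifted _ ⟩
        polygonSum (map liftTrue (schreierEdges (suc m) L′)) (λ _ → false)
      ≈⟨ polygonSum-liftTrue (schreierEdges (suc m) L′) _ (λ _ → refl) ⟩
        polygonSum (schreierEdges (suc m) L′) (λ _ → false) ∎

  renormalised-grid : ∀ A x y z →
                      renormalised (gridLabelling A x y z) ≗ gridLabelling ((((1# , x) ∥ (1# , y)) ⋯ A) ⋯ A) z x y
  renormalised-grid A x y z ga = refl
  renormalised-grid A x y z gb = refl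
  renormalised-grid A x y z gc = refl
  renormalised-grid A x y z gd = refl

  polygonSum-grid : ∀ m (A : Weights) x y z →
    polygonSum (schreierEdges (suc m) (gridLabelling A x y z)) (λ _ → false) ≈
      proj₁ A ^ᴿ (2 ^ m) * (1# + x * y) ^ᴿ bcExponent m * (1# + x * z) ^ᴿ bdExponent m * (1# + y * z) ^ᴿ cdExponent m
  polygonSum-grid zero (a₀ , a₁) x y z =
    solve 2 (λ a₀ a₁ → a₀ :* con 1 :+ a₁ :* con 0 := a₀ :* con 1 :* con 1 :* con 1 :* con 1) ≈-refl a₀ a₁
  polygonSum-grid (suc m) A x y z = begin
      polygonSum (schreierEdges (suc (suc m)) (gridLabelling A x y z)) (λ _ → false)
    ≈⟨ Renormalisation.polygonSum-renormalise (gridLabelling A x y z) m ⟩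
      polygonSum (schreierEdges (suc m) (renormalised (gridLabelling A x y z))) (λ _ → false)
    ≡⟨ cong (λ E → polygonSum E (λ _ → false)) (schreierEdges-cong (suc m) (renormalised-grid A x y z)) ⟩
      polygonSum (schreierEdges (suc m) (gridLabelling A′ z x y)) (λ _ → false)
    ≈⟨ polygonSum-grid m A′ z x y ⟩
      ((1# * 1# + x * y) * a * a) ^ᴿ N * (1# + z * x) ^ᴿ bcExponent m * (1# + z * y) ^ᴿ bdExponent m
        * p ^ᴿ cdExponent m
    ≈⟨ *-cong (*-cong (*-cong (≈-trans (^-distrib-* _ a N) (*-cong (^-distrib-* _ a N) ≈-refl))
                              (^-congˡ (bcExponent m) (+-cong ≈-refl (*-comm z x))))
                      (^-congˡ (bdExponent m) (+-cong ≈-refl (*-comm z y))))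
              ≈-refl ⟩
      (1# * 1# + x * y) ^ᴿ N * a ^ᴿ N * a ^ᴿ N * q ^ᴿ bcExponent m * r ^ᴿ bdExponent m * p ^ᴿ cdExponent m
    ≈⟨ *-cong (*-cong (*-cong (*-cong (*-cong (^-congˡ N (+-cong (*-identityˡ 1#) ≈-refl))
                                              ≈-refl) ≈-refl) ≈-refl) ≈-refl) ≈-refl ⟩
      p ^ᴿ N * a ^ᴿ N * a ^ᴿ N * q ^ᴿ bcExponent m * r ^ᴿ bdExponent m * p ^ᴿ cdExponent m
    ≈⟨ solve 5 (λ P A Q R P′ → P :* A :* A :* Q :* R :* P′ := (A :* A) :* (P :* P′) :* Q :* R)
             ≈-refl (p ^ᴿ N) (a ^ᴿ N) (q ^ᴿ bcExponent m) (r ^ᴿ bdExponent m) (p ^ᴿ cdExponent m) ⟩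
      (a ^ᴿ N * a ^ᴿ N) * (p ^ᴿ N * p ^ᴿ cdExponent m) * q ^ᴿ bcExponent m * r ^ᴿ bdExponent m
    ≈⟨ *-cong (*-cong (*-cong (≈-sym (≈-trans (^-congʳ a (cong (N ℕ.+_) (ℕₚ.+-identityʳ N))) (^-homo-* a N N)))
                              (≈-sym (^-homo-* p N (cdExponent m))))
                      ≈-refl)
              ≈-refl ⟩
      a ^ᴿ (2 ^ suc m) * p ^ᴿ bcExponent (suc m) * q ^ᴿ bdExponent (suc m) * r ^ᴿ cdExponent (suc m) ∎
    where
    A′ : Weights
    A′ = (((1# , x) ∥ (1# , y)) ⋯ A) ⋯ A
    N : ℕ
    N = 2 ^ m
    a p q r : Carrier
    a = proj₁ A
    p = 1# + x * y
    q = 1# + x * z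
    r = 1# + y * z

  1#^ᴿ : ∀ n → 1# ^ᴿ n ≈ 1#
  1#^ᴿ zero    = ≈-refl
  1#^ᴿ (suc n) = ≈-trans (*-identityˡ _) (1#^ᴿ n)

  pow≡^ᴿ : ∀ x n → pow R x n ≡ x ^ᴿ n
  pow≡^ᴿ x zero    = refl
  pow≡^ᴿ x (suc n) = cong (x *_) (pow≡^ᴿ x n)

  Gamma-closedForm : ∀ m a b c d {r₁ r₂ r₃} → ExponentsAt m r₁ r₂ r₃ →
    Gamma R (suc m) a b c d ≈
      pow R (1# + b * c) ((2 ^ suc (suc m) ∸ r₁) / 7) * pow R (1# + b * d) ((2 ^ suc m ∸ r₂) / 7)
        * pow R (1# + c * d) ((2 ^ m ∸ r₃) / 7)
  Gamma-closedForm m a b c d {r₁} {r₂} {r₃} (exponentsAt e₁ e₂ e₃) = begin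
      Gamma R (suc m) a b c d
    ≈⟨ Gamma≈polygonSum (suc m) a b c d ⟩
      polygonSum (schreierEdges (suc m) (gridLabelling (1# , a) b c d)) (λ _ → false)
    ≈⟨ polygonSum-grid m (1# , a) b c d ⟩
      1# ^ᴿ (2 ^ m) * (1# + b * c) ^ᴿ bcExponent m * (1# + b * d) ^ᴿ bdExponent m * (1# + c * d) ^ᴿ cdExponent m
    ≈⟨ *-cong (*-cong (≈-trans (*-cong (1#^ᴿ (2 ^ m)) ≈-refl) (*-identityˡ _)) ≈-refl) ≈-refl ⟩
      (1# + b * c) ^ᴿ bcExponent m * (1# + b * d) ^ᴿ bdExponent m * (1# + c * d) ^ᴿ cdExponent m
    ≡⟨ cong₂ _*_ (cong₂ _*_ (^ᴿ≡pow (1# + b * c) (bcExponent m) r₁ e₁) (^ᴿ≡pow (1# + b * d) (bdExponent m) r₂ e₂))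
                 (^ᴿ≡pow (1# + c * d) (cdExponent m) r₃ e₃) ⟩
      pow R (1# + b * c) ((2 ^ suc (suc m) ∸ r₁) / 7) * pow R (1# + b * d) ((2 ^ suc m ∸ r₂) / 7)
        * pow R (1# + c * d) ((2 ^ m ∸ r₃) / 7) ∎
    where
    ^ᴿ≡pow : ∀ x e r {p} → 7 ℕ.* e ℕ.+ r ≡ p → x ^ᴿ e ≡ pow R x ((p ∸ r) / 7)
    ^ᴿ≡pow x e r 7e+r≡p = trans (sym (pow≡^ᴿ x e)) (cong (pow R x) (sym (exponent-from e r 7e+r≡p)))

mainTheorem10 : {c ℓ : Level} (R : CommutativeRing c ℓ) (n : ℕ) → 1 ≤ n →
    (a b c d : CommutativeRing.Carrier R) →
    let open CommutativeRing R in
    (n % 3 ≡ 0 → Gamma R n a b c d ≈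
        pow R (1# + b * c) (((2 ^ suc n) ∸ 2) / 7) * pow R (1# + b * d) (((2 ^ n) ∸ 1) / 7)
          * pow R (1# + c * d) (((2 ^ (n ∸ 1)) ∸ 4) / 7))
    × (n % 3 ≡ 1 → Gamma R n a b c d ≈
        pow R (1# + b * c) (((2 ^ suc n) ∸ 4) / 7) * pow R (1# + b * d) (((2 ^ n) ∸ 2) / 7)
          * pow R (1# + c * d) (((2 ^ (n ∸ 1)) ∸ 1) / 7))
    × (n % 3 ≡ 2 → Gamma R n a b c d ≈
        pow R (1# + b * c) (((2 ^ suc n) ∸ 1) / 7) * pow R (1# + b * d) (((2 ^ n) ∸ 4) / 7)
          * pow R (1# + c * d) (((2 ^ (n ∸ 1)) ∸ 2) / 7))
mainTheorem10 R (suc m) _ a b c d with exponentsAt-residue m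
... | e₀ , e₁ , e₂ =
  Gamma-closedForm m a b c d ∘ e₀ , Gamma-closedForm m a b c d ∘ e₁ , Gamma-closedForm m a b c d ∘ e₂
  where open SchreierPolygonSums R using (Gamma-closedForm)
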